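{- Let $n$ be a positive integer and suppose $V$ is a three-dimensional subspace of the $\mathbb{Z}_2$-vector space of subgraphs of $K_n$ such that the complement of every non-zero vector in $V$ is triangle-free. Then $n \leq 8$.
   Context: Subgraphs of $K_n$ (on a fixed vertex set of size $n$, identified with their edge sets) form a vector space over $\mathbb{Z}_2$ under symmetric difference; the zero vector is the empty graph. The complement of a graph is taken with respect to $K_n$. -}

module Defs where

open import Data.Nat using (ℕ)
open import Data.Fin using (Fin)
open import Data.Bool using (Bool; true; false; _xor_; _∧_)
open import Data.Product using (_×_; Σ; ∃-syntax)
open import Relation.Binary.PropositionalEquality using (_≡_; _≢_)
open import Relation.Nullary using (¬_)

-- Only the values on pairs of distinct vertices matter; we require the
-- indicator to be symmetric and false on the diagonal (loopless).
record Graph (n : ℕ) : Set where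
  constructor mkGraph
  field
    adj   : Fin n → Fin n → Bool
    sym   : ∀ i j → adj i j ≡ adj j i
    irrefl : ∀ i → adj i i ≡ false
open Graph public

Adj : ℕ → Set
Adj n = Fin n → Fin n → Bool

_·_ : ∀ {n} → Bool → Adj n → Adj n
(e · A) i j = e ∧ A i j

_⊕_ : ∀ {n} → Adj n → Adj n → Adj n
(A ⊕ B) i j = A i j xor B i j

comb3 : ∀ {n} → Bool → Bool → Bool → Adj n → Adj n → Adj n → Adj n
comb3 e₁ e₂ e₃ a b c = ((e₁ · a) ⊕ (e₂ · b)) ⊕ (e₃ · c)

IsZero : ∀ {n} → Adj n → Set
IsZero {n} A = ∀ (i j : Fin n) → i ≢ j → A i j ≡ false

ComplementTriangleFree : ∀ {n} → Adj n → Set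
ComplementTriangleFree {n} A =
  ¬ (Σ (Fin n) λ i → Σ (Fin n) λ j → Σ (Fin n) λ k →
       i ≢ j × j ≢ k × i ≢ k ×
       A i j ≡ false × A j k ≡ false × A i k ≡ false)

NonZeroCoeffs : Bool → Bool → Bool → Set
NonZeroCoeffs e₁ e₂ e₃ = ¬ (e₁ ≡ false × e₂ ≡ false × e₃ ≡ false)

LinIndep3 : ∀ {n} → Graph n → Graph n → Graph n → Set
LinIndep3 a b c = ∀ e₁ e₂ e₃ → NonZeroCoeffs e₁ e₂ e₃ →
  ¬ IsZero (comb3 e₁ e₂ e₃ (adj a) (adj b) (adj c))

-- Label each edge ij by the vector ℓ(ij) = (a_ij, b_ij, c_ij) ∈ Z₂³, so that the
-- combination e₁a + e₂b + e₃c misses ij exactly when e ⊥ ℓ(ij). The hypothesis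
-- then says that no triangle has its three labels orthogonal to a common non-zero e.
-- Any two vectors of Z₂³ have a common non-zero orthogonal vector, so in a triangle
-- no label is 0 and the two labels at a vertex differ. Hence, for n ≥ 1, the n − 1
-- edges at a fixed vertex carry distinct labels in Z₂³ ∖ {0}, and n − 1 ≤ 7.
module Submission where

open import Defs using (Graph; adj; comb3; NonZeroCoeffs; ComplementTriangleFree; LinIndep3)
open import Algebra.Bundles using (CommutativeRing)
open import Data.Bool using (Bool; true; false; _xor_; _∧_; _∨_; T)
open import Data.Bool.Properties using (∧-distribʳ-xor; ∧-zeroʳ; xor-∧-commutativeRing)
open import Data.Fin using (Fin; suc; _≟_)
open import Data.Fin.Patterns using (0F; 1F; 2F; 3F; 4F; 5F; 6F)
open import Data.Fin.Properties using (injective⇒≤; suc-injective)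
open import Data.Nat using (ℕ; suc; _≤_; NonZero; s≤s)
open import Data.Product using (∃-syntax; _×_; _,_)
open import Function.Base using (_∘_)
open import Function.Definitions using (Injective)
open import Relation.Binary.PropositionalEquality
  using (_≡_; _≢_; refl; sym; trans; cong; cong₂; module ≡-Reasoning)
open import Relation.Nullary using (yes; no; contradiction)

open import Algebra.Properties.CommutativeSemigroup
  (CommutativeRing.+-commutativeSemigroup xor-∧-commutativeRing) using (interchange)

Bool³ : Set
Bool³ = Bool × Bool × Bool

𝟎 : Bool³
𝟎 = false , false , false

infixl 6 _+ᵥ_
infix 7 _∙_

_+ᵥ_ : Bool³ → Bool³ → Bool³
(x₁ , x₂ , x₃) +ᵥ (y₁ , y₂ , y₃) = x₁ xor y₁ , x₂ xor y₂ , x₃ xor y₃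

_∙_ : Bool³ → Bool³ → Bool
(e₁ , e₂ , e₃) ∙ (x₁ , x₂ , x₃) = ((e₁ ∧ x₁) xor (e₂ ∧ x₂)) xor (e₃ ∧ x₃)

NonZero³ : Bool³ → Set
NonZero³ (e₁ , e₂ , e₃) = T (e₁ ∨ e₂ ∨ e₃)

NonZero³⇒NonZeroCoeffs : ∀ {e₁ e₂ e₃} → NonZero³ (e₁ , e₂ , e₃) → NonZeroCoeffs e₁ e₂ e₃
NonZero³⇒NonZeroCoeffs e≢𝟎 (refl , refl , refl) = e≢𝟎

∙-zeroʳ : ∀ e → e ∙ 𝟎 ≡ false
∙-zeroʳ (e₁ , e₂ , e₃) rewrite ∧-zeroʳ e₁ | ∧-zeroʳ e₂ | ∧-zeroʳ e₃ = refl

∙-distribʳ-+ᵥ : ∀ f g x → (f +ᵥ g) ∙ x ≡ f ∙ x xor g ∙ x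
∙-distribʳ-+ᵥ (f₁ , f₂ , f₃) (g₁ , g₂ , g₃) (x₁ , x₂ , x₃) = begin
  (((f₁ xor g₁) ∧ x₁) xor ((f₂ xor g₂) ∧ x₂)) xor ((f₃ xor g₃) ∧ x₃)
    ≡⟨ cong₂ _xor_ (cong₂ _xor_ (∧-distribʳ-xor x₁ f₁ g₁) (∧-distribʳ-xor x₂ f₂ g₂))
                   (∧-distribʳ-xor x₃ f₃ g₃) ⟩
  ((u₁ xor v₁) xor (u₂ xor v₂)) xor (u₃ xor v₃)
    ≡⟨ cong (_xor (u₃ xor v₃)) (interchange u₁ v₁ u₂ v₂) ⟩
  ((u₁ xor u₂) xor (v₁ xor v₂)) xor (u₃ xor v₃)
    ≡⟨ interchange (u₁ xor u₂) (v₁ xor v₂) u₃ v₃ ⟩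
  ((u₁ xor u₂) xor u₃) xor ((v₁ xor v₂) xor v₃)
    ∎
  where
  open ≡-Reasoning
  u₁ u₂ u₃ v₁ v₂ v₃ : Bool
  u₁ = f₁ ∧ x₁; u₂ = f₂ ∧ x₂; u₃ = f₃ ∧ x₃
  v₁ = g₁ ∧ x₁; v₂ = g₂ ∧ x₂; v₃ = g₃ ∧ x₃

record OrthogonalPlane (x : Bool³) : Set where
  constructor plane
  field
    f g : Bool³
    f≢𝟎 : NonZero³ f
    g≢𝟎 : NonZero³ g
    f+g≢𝟎 : NonZero³ (f +ᵥ g)
    f⊥x : f ∙ x ≡ false
    g⊥x : g ∙ x ≡ false

orthogonalPlane : ∀ x → OrthogonalPlane x
orthogonalPlane (false , false , false) = plane (true , false , false) (false , true , false) _ _ _ refl refl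
orthogonalPlane (false , false , true)  = plane (true , false , false) (false , true , false) _ _ _ refl refl
orthogonalPlane (false , true  , false) = plane (true , false , false) (false , false , true) _ _ _ refl refl
orthogonalPlane (false , true  , true)  = plane (true , false , false) (false , true , true)  _ _ _ refl refl
orthogonalPlane (true  , false , false) = plane (false , true , false) (false , false , true) _ _ _ refl refl
orthogonalPlane (true  , false , true)  = plane (false , true , false) (true , false , true)  _ _ _ refl refl
orthogonalPlane (true  , true  , false) = plane (false , false , true) (true , true , false)  _ _ _ refl refl
orthogonalPlane (true  , true  , true)  = plane (true , true , false)  (false , true , true)  _ _ _ refl refl

-- One of f, g, f + g in a plane orthogonal to x is also orthogonal to y.
∃-nonzero-orthogonal : ∀ x y → ∃[ e ] NonZero³ e × e ∙ x ≡ false × e ∙ y ≡ false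
∃-nonzero-orthogonal x y with orthogonalPlane x
... | plane f g f≢𝟎 g≢𝟎 f+g≢𝟎 f⊥x g⊥x with f ∙ y in f∙y | g ∙ y in g∙y
...   | false | _     = f , f≢𝟎 , f⊥x , f∙y
...   | true  | false = g , g≢𝟎 , g⊥x , g∙y
...   | true  | true  = f +ᵥ g , f+g≢𝟎
                      , trans (∙-distribʳ-+ᵥ f g x) (cong₂ _xor_ f⊥x g⊥x)
                      , trans (∙-distribʳ-+ᵥ f g y) (cong₂ _xor_ f∙y g∙y)

-- The binary numeral of x, minus one; 𝟎 is sent to the junk value 0F.
encode : Bool³ → Fin 7
encode (false , false , false) = 0F
encode (false , false , true)  = 0F
encode (false , true  , false) = 1F
encode (false , true  , true)  = 2F
encode (true  , false , false) = 3F
encode (true  , false , true)  = 4F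
encode (true  , true  , false) = 5F
encode (true  , true  , true)  = 6F

decode : Fin 7 → Bool³
decode 0F = false , false , true
decode 1F = false , true  , false
decode 2F = false , true  , true
decode 3F = true  , false , false
decode 4F = true  , false , true
decode 5F = true  , true  , false
decode 6F = true  , true  , true

decode-encode : ∀ x → x ≢ 𝟎 → decode (encode x) ≡ x
decode-encode (false , false , false) x≢𝟎 = contradiction refl x≢𝟎
decode-encode (false , false , true)  _ = refl
decode-encode (false , true  , false) _ = refl
decode-encode (false , true  , true)  _ = refl
decode-encode (true  , false , false) _ = refl
decode-encode (true  , false , true)  _ = refl
decode-encode (true  , true  , false) _ = refl
decode-encode (true  , true  , true)  _ = refl

NoOrthogonalTriangle : ∀ {n} → (Fin n → Fin n → Bool³) → Set
NoOrthogonalTriangle ℓ = ∀ e → NonZero³ e → ComplementTriangleFree (λ i j → e ∙ ℓ i j)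

module Triangles {n} {ℓ : Fin n → Fin n → Bool³} (triangleFree : NoOrthogonalTriangle ℓ) where

  triangle-edge-nonzero : ∀ {i j k} → i ≢ j → j ≢ k → i ≢ k → ℓ i j ≢ 𝟎
  triangle-edge-nonzero {i} {j} {k} i≢j j≢k i≢k ℓij≡𝟎
    with e , e≢𝟎 , e⊥jk , e⊥ik ← ∃-nonzero-orthogonal (ℓ j k) (ℓ i k) =
    triangleFree e e≢𝟎 (i , j , k , i≢j , j≢k , i≢k , e⊥ij , e⊥jk , e⊥ik)
    where
    e⊥ij : e ∙ ℓ i j ≡ false
    e⊥ij = trans (cong (e ∙_) ℓij≡𝟎) (∙-zeroʳ e)

  triangle-sides-differ : ∀ {i j k} → i ≢ j → j ≢ k → i ≢ k → ℓ i j ≢ ℓ i k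
  triangle-sides-differ {i} {j} {k} i≢j j≢k i≢k ℓij≡ℓik
    with e , e≢𝟎 , e⊥ij , e⊥jk ← ∃-nonzero-orthogonal (ℓ i j) (ℓ j k) =
    triangleFree e e≢𝟎 (i , j , k , i≢j , j≢k , i≢k , e⊥ij , e⊥jk , e⊥ik)
    where
    e⊥ik : e ∙ ℓ i k ≡ false
    e⊥ik = trans (cong (e ∙_) (sym ℓij≡ℓik)) e⊥ij

star-labels-injective : ∀ {m} (ℓ : Fin (suc m) → Fin (suc m) → Bool³) →
  NoOrthogonalTriangle ℓ → Injective _≡_ _≡_ (λ v → encode (ℓ 0F (suc v)))
star-labels-injective ℓ triangleFree {u} {w} encode-eq with u ≟ w
... | yes u≡w = u≡w
... | no u≢w = contradiction ℓ0u≡ℓ0w (triangle-sides-differ 0≢u su≢sw 0≢w)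
  where
  open Triangles triangleFree
  open ≡-Reasoning
  0≢u : 0F ≢ suc u
  0≢u ()
  0≢w : 0F ≢ suc w
  0≢w ()
  su≢sw : suc u ≢ suc w
  su≢sw = u≢w ∘ suc-injective
  ℓ0u≡ℓ0w : ℓ 0F (suc u) ≡ ℓ 0F (suc w)
  ℓ0u≡ℓ0w = begin
    ℓ 0F (suc u)
      ≡⟨ decode-encode _ (triangle-edge-nonzero 0≢u su≢sw 0≢w) ⟨
    decode (encode (ℓ 0F (suc u)))
      ≡⟨ cong decode encode-eq ⟩
    decode (encode (ℓ 0F (suc w)))
      ≡⟨ decode-encode _ (triangle-edge-nonzero 0≢w (su≢sw ∘ sym) 0≢u) ⟩
    ℓ 0F (suc w)
      ∎

proposition1 : (n : ℕ) → .{{_ : NonZero n}} → (a b c : Graph n) →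
    LinIndep3 a b c →
    (∀ e₁ e₂ e₃ → NonZeroCoeffs e₁ e₂ e₃ →
      ComplementTriangleFree (comb3 e₁ e₂ e₃ (adj a) (adj b) (adj c))) →
    n ≤ 8
proposition1 (suc m) a b c _ triangleFree =
  s≤s (injective⇒≤ (star-labels-injective label labelTriangleFree))
  where
  label : Fin (suc m) → Fin (suc m) → Bool³
  label i j = adj a i j , adj b i j , adj c i j
  labelTriangleFree : NoOrthogonalTriangle label
  labelTriangleFree (e₁ , e₂ , e₃) e≢𝟎 = triangleFree e₁ e₂ e₃ (NonZero³⇒NonZeroCoeffs e≢𝟎)
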